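{- Let $m\geq 3$ and $n\geq 2$ be integers, let $K_m$ be the complete graph of order $m$ and let $H_n$ be a connected graph of order $n$. Then $rvc(K_m\diamond H_n)=\lceil m/3\rceil$.
   Context: All graphs are finite, simple, connected and undirected. For $k\in\mathbb{N}$, a rainbow vertex $k$-coloring of $G$ is a function $c: V(G)\to\{1,\dots,k\}$ such that every two vertices $u,v$ are joined by a $u$–$v$ path whose internal vertices have pairwise distinct colors; $rvc(G)$ is the smallest positive integer $k$ for which $G$ has a rainbow vertex $k$-coloring. The edge corona $G\diamond H$ is obtained from one copy of $G$ and $|E(G)|$ copies of $H$, where, enumerating the edges of $G$ as $e_1,\dots,e_{|E(G)|}$, both end vertices of $e_j$ are joined to every vertex of the $j$-th copy of $H$. -}

module Defs where

open import Data.Nat using (ℕ; _≤_; _<_)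
open import Data.Fin using (Fin; toℕ)
open import Data.Fin.Properties using (_≟_)
open import Data.Bool using (Bool; true; false; not; T)
open import Data.List using (List; []; _∷_; _++_; map)
open import Data.List.Relation.Unary.Unique.Propositional using (Unique)
open import Data.Product using (Σ; _×_; _,_; ∃; proj₁; proj₂)
open import Data.Sum using (_⊎_; inj₁; inj₂)
open import Relation.Binary.PropositionalEquality using (_≡_; _≢_; refl)
open import Relation.Nullary using (does)

record Graph (n : ℕ) : Set where
  field
    adj    : Fin n → Fin n → Bool
    sym    : ∀ i j → adj i j ≡ adj j i
    irrefl : ∀ i → adj i i ≡ false
open Graph public

Adj : ∀ {n} → Graph n → Fin n → Fin n → Set
Adj G i j = T (adj G i j)

-- Walk u → v whose list of internal vertices is the given list.
data Walk {V : Set} (E : V → V → Set) : V → List V → V → Set where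
  edge : ∀ {u v} → E u v → Walk E u [] v
  step : ∀ {u w v is} → E u w → Walk E w is v → Walk E u (w ∷ is) v

Path : {V : Set} (E : V → V → Set) → V → List V → V → Set
Path E u is v = Walk E u is v × Unique (u ∷ is ++ v ∷ [])

Connected : {V : Set} (E : V → V → Set) → Set
Connected {V} E = ∀ (u v : V) → u ≢ v → ∃ λ is → Path E u is v

IsRainbowVertexColoring : {V : Set} (E : V → V → Set) (k : ℕ) → (V → Fin k) → Set
IsRainbowVertexColoring {V} E k c =
  ∀ (u v : V) → u ≢ v → ∃ λ is → Path E u is v × Unique (map c is)

HasRVC : {V : Set} (E : V → V → Set) → ℕ → Set
HasRVC {V} E k = Σ (V → Fin k) (IsRainbowVertexColoring E k)

RVCIs : {V : Set} (E : V → V → Set) → ℕ → Set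
RVCIs E k = 1 ≤ k × HasRVC E k × (∀ k' → 1 ≤ k' → HasRVC E k' → k ≤ k')

K : (m : ℕ) → Graph m
K m = record
  { adj    = λ i j → not (does (i ≟ j))
  ; sym    = symK
  ; irrefl = irrK
  }
  where
  symK : ∀ i j → not (does (i ≟ j)) ≡ not (does (j ≟ i))
  symK i j with i ≟ j | j ≟ i
  ... | Relation.Nullary.yes _ | Relation.Nullary.yes _ = refl
  ... | Relation.Nullary.no _  | Relation.Nullary.no _  = refl
  ... | Relation.Nullary.yes p | Relation.Nullary.no q  = Data.Empty.⊥-elim (q (Relation.Binary.PropositionalEquality.sym p))
    where import Data.Empty
  ... | Relation.Nullary.no q  | Relation.Nullary.yes p = Data.Empty.⊥-elim (q (Relation.Binary.PropositionalEquality.sym p))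
    where import Data.Empty
  irrK : ∀ i → not (does (i ≟ i)) ≡ false
  irrK i with i ≟ i
  ... | Relation.Nullary.yes _ = refl
  ... | Relation.Nullary.no q  = Data.Empty.⊥-elim (q refl)
    where import Data.Empty

Edge : ∀ {m} → Graph m → Set
Edge {m} G = Σ (Fin m × Fin m) λ p → (toℕ (proj₁ p) < toℕ (proj₂ p)) × Adj G (proj₁ p) (proj₂ p)

-- Vertices: the vertices of G, plus one copy of H for each edge of G.
CoronaV : ∀ {m n} → Graph m → Graph n → Set
CoronaV {m} {n} G H = Fin m ⊎ (Edge G × Fin n)

CoronaAdj : ∀ {m n} (G : Graph m) (H : Graph n) → CoronaV G H → CoronaV G H → Set
CoronaAdj G H (inj₁ a) (inj₁ b) = Adj G a b
CoronaAdj G H (inj₁ a) (inj₂ (e , w)) = a ≡ proj₁ (proj₁ e) ⊎ a ≡ proj₂ (proj₁ e)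
CoronaAdj G H (inj₂ (e , w)) (inj₁ a) = a ≡ proj₁ (proj₁ e) ⊎ a ≡ proj₂ (proj₁ e)
CoronaAdj G H (inj₂ (e , w)) (inj₂ (e' , w')) = proj₁ e ≡ proj₁ e' × Adj H w w'

{-# OPTIONS --safe #-}
-- A vertex in the copy of H attached to an edge ab of K_m is adjacent only to a, b and to
-- its own copy.  So every path between the copies at two disjoint edges ab and cd passes
-- through an endpoint of ab and through an endpoint of cd, and these are distinct internal
-- vertices.  Hence a rainbow colouring never gives the same colour to four vertices of K_m,
-- which forces m ≤ 3k.  Conversely, if no colour is used on four vertices of K_m, then for
-- two disjoint edges some endpoint of one and some endpoint of the other get different
-- colours, so every pair of vertices is joined by a rainbow path with at most two internal
-- vertices, all of them in K_m.  The colouring i ↦ ⌊i/3⌋ does this with ⌈m/3⌉ colours.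
module Submission where

open import Defs hiding (sym)
open import Data.Nat using (ℕ; zero; suc; _≤_; _<_; _+_; _*_; _/_; _%_; z≤n; s≤s; s≤s⁻¹; NonZero)
open import Data.Nat.Properties
open import Data.Nat.DivMod
open import Data.Fin using (Fin; toℕ; fromℕ<)
open import Data.Fin.Properties using (toℕ-injective; fromℕ<-injective; toℕ<n) renaming (_≟_ to _≟ᶠ_)
open import Data.List using (List; []; _∷_; _++_; [_]; map; length; filter; reverse)
open import Data.List.Properties using (length-map; length-tabulate; unfold-reverse)
open import Data.List.Membership.Propositional using (_∈_)
open import Data.List.Membership.Propositional.Properties using (∈-map⁺)
open import Data.List.Relation.Unary.All as All using (All; []; _∷_)
open import Data.List.Relation.Unary.All.Properties using (all-filter; filter⁺) renaming (map⁺ to All-map⁺)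
open import Data.List.Relation.Unary.Any using (here; there)
open import Data.List.Relation.Unary.Any.Properties using (reverse⁻)
open import Data.List.Relation.Unary.AllPairs using ([]; _∷_)
open import Data.List.Relation.Unary.Unique.Propositional using (Unique)
import Data.List.Relation.Unary.Unique.Propositional.Properties as Unique
open import Data.Product using (∃; ∃₂; _×_; _,_; proj₁)
open import Data.Sum using (_⊎_; inj₁; inj₂; [_,_]′; swap)
open import Data.Sum.Properties using (inj₁-injective)
open import Data.Empty using (⊥; ⊥-elim)
open import Data.Bool using (T)
open import Data.Unit using (tt)
open import Function using (_∘_; id)
open import Function.Definitions using (Injective)
open import Relation.Nullary using (Dec; yes; no)
open import Relation.Nullary.Decidable using (_⊎-dec_)
open import Relation.Unary using (Decidable)
open import Relation.Unary.Properties using (∁?)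
open import Relation.Binary.Definitions using (tri<; tri≈; tri>)
open import Relation.Binary.PropositionalEquality hiding ([_])

private
  variable
    A B : Set

FibresAtMost : ℕ → (A → B) → Set
FibresAtMost {A} r f = ∀ t (xs : List A) → Unique xs → All (λ x → f x ≡ t) xs → length xs ≤ r

injective⇒fibresAtMost1 : {f : A → B} → Injective _≡_ _≡_ f → FibresAtMost 1 f
injective⇒fibresAtMost1 f-inj t []          _               _                 = z≤n
injective⇒fibresAtMost1 f-inj t (_ ∷ [])    _               _                 = s≤s z≤n
injective⇒fibresAtMost1 f-inj t (_ ∷ _ ∷ _) ((x≢y ∷ _) ∷ _) (fx≡t ∷ fy≡t ∷ _) =
  ⊥-elim (x≢y (f-inj (trans fx≡t (sym fy≡t))))

fibresAtMost-∘ : ∀ {C : Set} {r} {f : A → B} {h : B → C} →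
                 Injective _≡_ _≡_ h → FibresAtMost r f → FibresAtMost r (h ∘ f)
fibresAtMost-∘         h-inj f-fib t []       _ _               = z≤n
fibresAtMost-∘ {f = f} h-inj f-fib t (x ∷ xs) u hfxs≡t@(hfx≡t ∷ _) =
  f-fib (f x) (x ∷ xs) u (All.map (λ hfy≡t → h-inj (trans hfy≡t (sym hfx≡t))) hfxs≡t)

length-filter+length-filter-∁ : ∀ {P : A → Set} (P? : Decidable P) xs →
                                length (filter P? xs) + length (filter (∁? P?) xs) ≡ length xs
length-filter+length-filter-∁ P? []       = refl
length-filter+length-filter-∁ P? (x ∷ xs) with P? x
... | yes _ = cong suc (length-filter+length-filter-∁ P? xs)
... | no  _ = trans (+-suc _ _) (cong suc (length-filter+length-filter-∁ P? xs))

fibresAtMost⇒length≤ : ∀ {r} (f : A → ℕ) → FibresAtMost r f →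
                       ∀ k {xs} → Unique xs → All (λ x → f x < k) xs → length xs ≤ k * r
fibresAtMost⇒length≤         f f-fib zero    {[]}    _ _          = z≤n
fibresAtMost⇒length≤         f f-fib zero    {_ ∷ _} _ (() ∷ _)
fibresAtMost⇒length≤ {r = r} f f-fib (suc k) {xs}    u f<1+k = begin
  length xs                                              ≡⟨ length-filter+length-filter-∁ ≡k? xs ⟨
  length (filter ≡k? xs) + length (filter (∁? ≡k?) xs)  ≤⟨ +-mono-≤ fibre-k rest ⟩
  r + k * r                                              ∎
  where
  open ≤-Reasoning
  ≡k? : Decidable (λ x → f x ≡ k)
  ≡k? x = f x ≟ k
  f<k : All (λ x → f x < k) (filter (∁? ≡k?) xs)
  f<k = All.zipWith (λ (fx<1+k , fx≢k) → ≤∧≢⇒< (s≤s⁻¹ fx<1+k) fx≢k)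
                    (filter⁺ (∁? ≡k?) f<1+k , all-filter (∁? ≡k?) xs)
  fibre-k : length (filter ≡k? xs) ≤ r
  fibre-k = f-fib k _ (Unique.filter⁺ ≡k? u) (all-filter ≡k? xs)
  rest : length (filter (∁? ≡k?) xs) ≤ k * r
  rest = fibresAtMost⇒length≤ f f-fib k (Unique.filter⁺ _ u) f<k

fibresAtMost⇒length≤-Fin : ∀ {k r xs} (f : A → Fin k) → FibresAtMost r f → Unique xs → length xs ≤ k * r
fibresAtMost⇒length≤-Fin {k = k} {xs = xs} f f-fib u =
  fibresAtMost⇒length≤ (toℕ ∘ f) (fibresAtMost-∘ toℕ-injective f-fib) k u
                       (All.universal (λ x → toℕ<n (f x)) xs)

jointlyInjective⇒fibresAtMost : ∀ {r} {f : A → B} (h : A → Fin r) →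
                                (∀ {x y} → f x ≡ f y → h x ≡ h y → x ≡ y) → FibresAtMost r f
jointlyInjective⇒fibresAtMost {r = r} {f} h fh-inj t xs u fxs≡t = begin
  length xs         ≡⟨ length-map h xs ⟨
  length (map h xs) ≤⟨ fibresAtMost⇒length≤-Fin id (injective⇒fibresAtMost1 id) (map-unique u fxs≡t) ⟩
  r * 1             ≡⟨ *-identityʳ r ⟩
  r                 ∎
  where
  open ≤-Reasoning
  map-unique : ∀ {ys} → Unique ys → All (λ y → f y ≡ t) ys → Unique (map h ys)
  map-unique []          []            = []
  map-unique (x≢ys ∷ u) (fx≡t ∷ fys≡t) =
    All-map⁺ (All.zipWith (λ (x≢y , fy≡t) hx≡hy → x≢y (fh-inj (trans fx≡t (sym fy≡t)) hx≡hy))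
                          (x≢ys , fys≡t))
    ∷ map-unique u fys≡t

divMod-injective : ∀ {a b} n .{{_ : NonZero n}} → a / n ≡ b / n → a % n ≡ b % n → a ≡ b
divMod-injective {a} {b} n a/n≡b/n a%n≡b%n = begin
  a                 ≡⟨ m≡m%n+[m/n]*n a n ⟩
  a % n + a / n * n ≡⟨ cong₂ (λ r q → r + q * n) a%n≡b%n a/n≡b/n ⟩
  b % n + b / n * n ≡⟨ m≡m%n+[m/n]*n b n ⟨
  b                 ∎
  where open ≡-Reasoning

quotient<⌈/3⌉ : ∀ {i m} → i < m → i / 3 < (m + 2) / 3
quotient<⌈/3⌉ {i} {m} i<m = begin-strict
  i / 3         <⟨ n<1+n (i / 3) ⟩
  1 + i / 3     ≡⟨ m/n≡1+[m∸n]/n (m≤m+n 3 i) ⟨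
  (3 + i) / 3   ≤⟨ /-monoˡ-≤ 3 (subst (_≤ m + 2) (+-comm (suc i) 2) (+-monoˡ-≤ 2 i<m)) ⟩
  (m + 2) / 3   ∎
  where open ≤-Reasoning

⌈/3⌉-least : ∀ {m k} → m ≤ k * 3 → (m + 2) / 3 ≤ k
⌈/3⌉-least {m} {k} m≤3k =
  s≤s⁻¹ (m<n*o⇒m/o<n (subst (_≤ 3 + k * 3) (cong suc (+-comm 2 m)) (+-monoʳ-≤ 3 m≤3k)))

thirds : ∀ {m} → Fin m → Fin ((m + 2) / 3)
thirds i = fromℕ< (quotient<⌈/3⌉ (toℕ<n i))

thirds-fibresAtMost3 : ∀ {m} → FibresAtMost 3 (thirds {m})
thirds-fibresAtMost3 {m} = jointlyInjective⇒fibresAtMost (λ i → toℕ i mod 3) λ {i} {j} same-third same-mod →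
  toℕ-injective (divMod-injective 3 (fromℕ<-injective _ _ (third< i) (third< j) same-third)
                                    (fromℕ<-injective _ _ _ _ same-mod))
  where
  third< : (i : Fin m) → toℕ i / 3 < (m + 2) / 3
  third< i = quotient<⌈/3⌉ (toℕ<n i)

unique-map-injective : ∀ (f : A → B) {xs x y} → Unique (map f xs) → x ∈ xs → y ∈ xs → f x ≡ f y → x ≡ y
unique-map-injective f (_   ∷ _) (here refl) (here refl) _     = refl
unique-map-injective f (fx≢ ∷ _) (here refl) (there y∈)  fx≡fy = ⊥-elim (All.lookup fx≢ (∈-map⁺ f y∈) fx≡fy)
unique-map-injective f (fy≢ ∷ _) (there x∈)  (here refl) fx≡fy = ⊥-elim (All.lookup fy≢ (∈-map⁺ f x∈) (sym fx≡fy))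
unique-map-injective f (_   ∷ u) (there x∈)  (there y∈)  fx≡fy = unique-map-injective f u x∈ y∈ fx≡fy

module _ {V : Set} {E : V → V → Set} where

  walk-snoc : ∀ {u is v w} → Walk E u is v → E v w → Walk E u (is ++ [ v ]) w
  walk-snoc (edge uv)      vw = step uv (edge vw)
  walk-snoc (step uw rest) vw = step uw (walk-snoc rest vw)

  walk-reverse : (∀ u v → E u v → E v u) → ∀ {u is v} → Walk E u is v → Walk E v (reverse is) u
  walk-reverse E-sym (edge {u} {v} uv) = edge (E-sym u v uv)
  walk-reverse E-sym {u} {w ∷ is} {v} (step uw rest) =
    subst (λ js → Walk E v js u) (sym (unfold-reverse w is))
          (walk-snoc (walk-reverse E-sym rest) (E-sym u w uw))

  module _ {k} (c : V → Fin k) where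

    RainbowPath : V → V → Set
    RainbowPath u v = ∃ λ is → Path E u is v × Unique (map c is)

    rainbowPath₀ : ∀ {u v} → E u v → u ≢ v → RainbowPath u v
    rainbowPath₀ uv u≢v = [] , (edge uv , (u≢v ∷ []) ∷ [] ∷ []) , []

    rainbowPath₁ : ∀ {u v} p → E u p → E p v → u ≢ p → u ≢ v → p ≢ v → RainbowPath u v
    rainbowPath₁ p up pv u≢p u≢v p≢v =
      [ p ] , (step up (edge pv) , (u≢p ∷ u≢v ∷ []) ∷ (p≢v ∷ []) ∷ [] ∷ []) , [] ∷ []

    rainbowPath₂ : ∀ {u v} p q → E u p → E p q → E q v →
                   u ≢ p → u ≢ q → u ≢ v → p ≢ v → q ≢ v → c p ≢ c q → RainbowPath u v
    rainbowPath₂ p q up pq qv u≢p u≢q u≢v p≢v q≢v cp≢cq =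
      p ∷ q ∷ [] , (step up (step pq (edge qv))
          , (u≢p ∷ u≢q ∷ u≢v ∷ []) ∷ ((cp≢cq ∘ cong c) ∷ p≢v ∷ []) ∷ (q≢v ∷ []) ∷ [] ∷ [])
        , (cp≢cq ∷ []) ∷ [] ∷ []

module Corona {m n} (G : Graph m) (H : Graph n) where

  V : Set
  V = CoronaV G H

  E : V → V → Set
  E = CoronaAdj G H

  infix 4 _∈ₑ_ _∈ₑ?_

  _∈ₑ_ : Fin m → Edge G → Set
  q ∈ₑ ((a , b) , _) = q ≡ a ⊎ q ≡ b

  _∈ₑ?_ : ∀ q e → Dec (q ∈ₑ e)
  q ∈ₑ? ((a , b) , _) = (q ≟ᶠ a) ⊎-dec (q ≟ᶠ b)

  Disjoint : Edge G → Edge G → Set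
  Disjoint e e′ = ∀ {q} → q ∈ₑ e → q ∈ₑ e′ → ⊥

  Separating : (Fin m → B) → Set
  Separating κ = ∀ e e′ → Disjoint e e′ → ∃₂ λ p q → p ∈ₑ e × q ∈ₑ e′ × κ p ≢ κ q

  shared-or-disjoint : ∀ e e′ → (∃ λ p → p ∈ₑ e × p ∈ₑ e′) ⊎ Disjoint e e′
  shared-or-disjoint e@((a , b) , _) e′ with a ∈ₑ? e′ | b ∈ₑ? e′
  ... | yes a∈e′ | _        = inj₁ (a , inj₁ refl , a∈e′)
  ... | no  _    | yes b∈e′ = inj₁ (b , inj₂ refl , b∈e′)
  ... | no  a∉e′ | no  b∉e′ = inj₂ λ { (inj₁ refl) → a∉e′ ; (inj₂ refl) → b∉e′ }

  E-sym : ∀ u v → E u v → E v u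
  E-sym (inj₁ a)       (inj₁ b)        a~b           = subst T (Graph.sym G a b) a~b
  E-sym (inj₁ _)       (inj₂ _)        a∈e           = a∈e
  E-sym (inj₂ _)       (inj₁ _)        a∈e           = a∈e
  E-sym (inj₂ (_ , w)) (inj₂ (_ , w′)) (same , w~w′) = sym same , subst T (Graph.sym H w w′) w~w′

  walk-leaves-copy : ∀ {e w is e′ w′} e₀ → proj₁ e ≡ proj₁ e₀ → proj₁ e′ ≢ proj₁ e₀ →
                     Walk E (inj₂ (e , w)) is (inj₂ (e′ , w′)) → ∃ λ q → inj₁ q ∈ is × q ∈ₑ e₀
  walk-leaves-copy e₀ e≈e₀ e′≉e₀ (edge (e≈e′ , _)) = ⊥-elim (e′≉e₀ (trans (sym e≈e′) e≈e₀))
  walk-leaves-copy e₀ e≈e₀ e′≉e₀ (step {w = inj₁ q} q∈e _) =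
    q , here refl , subst (λ (a , b) → q ≡ a ⊎ q ≡ b) e≈e₀ q∈e
  walk-leaves-copy e₀ e≈e₀ e′≉e₀ (step {w = inj₂ _} (e≈e″ , _) rest)
    with q , q∈is , q∈e₀ ← walk-leaves-copy e₀ (trans (sym e≈e″) e≈e₀) e′≉e₀ rest =
    q , there q∈is , q∈e₀

  rainbow⇒separating : ∀ {k} {c : V → Fin k} → Fin n → IsRainbowVertexColoring E k c →
                       Separating (c ∘ inj₁)
  rainbow⇒separating {c = c} w c-rainbow e₁ e₂ e₁#e₂ =
    separate (c-rainbow (inj₂ (e₁ , w)) (inj₂ (e₂ , w)) λ { refl → e₁#e₂ (inj₁ refl) (inj₁ refl) })
    where
    e₂≉e₁ : proj₁ e₂ ≢ proj₁ e₁
    e₂≉e₁ e₂≈e₁ = e₁#e₂ (inj₁ refl) (inj₁ (cong proj₁ (sym e₂≈e₁)))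

    separate : RainbowPath c (inj₂ (e₁ , w)) (inj₂ (e₂ , w)) →
               ∃₂ λ p q → p ∈ₑ e₁ × q ∈ₑ e₂ × c (inj₁ p) ≢ c (inj₁ q)
    separate (is , (walk , _) , rainbow) =
      let p , p∈is , p∈e₁ = walk-leaves-copy e₁ refl e₂≉e₁ walk
          q , q∈is , q∈e₂ = walk-leaves-copy e₂ refl (e₂≉e₁ ∘ sym) (walk-reverse E-sym walk)
          p≢q : p ≢ q
          p≢q p≡q = e₁#e₂ p∈e₁ (subst (_∈ₑ e₂) (sym p≡q) q∈e₂)
      in p , q , p∈e₁ , q∈e₂ , p≢q ∘ inj₁-injective ∘ unique-map-injective c rainbow p∈is (reverse⁻ q∈is)

adjK : ∀ {m} {a b : Fin m} → a ≢ b → Adj (K m) a b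
adjK {a = a} {b} a≢b with a ≟ᶠ b
... | yes a≡b = a≢b a≡b
... | no  _   = tt

module CompleteCorona {m n : ℕ} (H : Graph n) where

  open Corona (K m) H public

  edgeBetween : (a b : Fin m) → a ≢ b → Edge (K m)
  edgeBetween a b a≢b with <-cmp (toℕ a) (toℕ b)
  ... | tri< a<b _ _ = (a , b) , a<b , adjK a≢b
  ... | tri≈ _ a≡b _ = ⊥-elim (a≢b (toℕ-injective a≡b))
  ... | tri> _ _ b<a = (b , a) , b<a , adjK (a≢b ∘ sym)

  ∈-edgeBetween : ∀ {q} a b a≢b → q ∈ₑ edgeBetween a b a≢b → q ≡ a ⊎ q ≡ b
  ∈-edgeBetween a b a≢b q∈ab with <-cmp (toℕ a) (toℕ b)
  ... | tri< _ _ _   = q∈ab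
  ... | tri≈ _ a≡b _ = ⊥-elim (a≢b (toℕ-injective a≡b))
  ... | tri> _ _ _   = swap q∈ab

  separating⇒fibresAtMost3 : {κ : Fin m → B} → Separating κ → FibresAtMost 3 κ
  separating⇒fibresAtMost3 sep t []                _ _ = z≤n
  separating⇒fibresAtMost3 sep t (_ ∷ [])          _ _ = s≤s z≤n
  separating⇒fibresAtMost3 sep t (_ ∷ _ ∷ [])      _ _ = s≤s (s≤s z≤n)
  separating⇒fibresAtMost3 sep t (_ ∷ _ ∷ _ ∷ [])  _ _ = s≤s (s≤s (s≤s z≤n))
  separating⇒fibresAtMost3 {κ = κ} sep t (a ∷ b ∷ c ∷ d ∷ _)
    ((a≢b ∷ a≢c ∷ a≢d ∷ _) ∷ (b≢c ∷ b≢d ∷ _) ∷ (c≢d ∷ _) ∷ _) (κa ∷ κb ∷ κc ∷ κd ∷ _) =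
    let p , q , p∈ab , q∈cd , κp≢κq = sep ab cd ab#cd
    in ⊥-elim (κp≢κq (trans (pair-coloured κa κb (∈-edgeBetween a b a≢b p∈ab))
                            (sym (pair-coloured κc κd (∈-edgeBetween c d c≢d q∈cd)))))
    where
    ab = edgeBetween a b a≢b
    cd = edgeBetween c d c≢d

    ab#cd : Disjoint ab cd
    ab#cd q∈ab q∈cd with ∈-edgeBetween a b a≢b q∈ab | ∈-edgeBetween c d c≢d q∈cd
    ... | inj₁ refl | inj₁ refl = a≢c refl
    ... | inj₁ refl | inj₂ refl = a≢d refl
    ... | inj₂ refl | inj₁ refl = b≢c refl
    ... | inj₂ refl | inj₂ refl = b≢d refl

    pair-coloured : ∀ {x y z} → κ x ≡ t → κ y ≡ t → z ≡ x ⊎ z ≡ y → κ z ≡ t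
    pair-coloured κx κy = [ (λ z≡x → trans (cong κ z≡x) κx) , (λ z≡y → trans (cong κ z≡y) κy) ]′

  fibresAtMost3⇒separating : ∀ {k} {κ : Fin m → Fin k} → FibresAtMost 3 κ → Separating κ
  fibresAtMost3⇒separating {κ = κ} fib e₁@((a , b) , a<b , _) e₂@((c , d) , c<d , _) e₁#e₂
    with κ a ≟ᶠ κ c | κ b ≟ᶠ κ c | κ a ≟ᶠ κ d
  ... | no κa≢κc | _        | _        = a , c , inj₁ refl , inj₁ refl , κa≢κc
  ... | yes _    | no κb≢κc | _        = b , c , inj₂ refl , inj₁ refl , κb≢κc
  ... | yes _    | yes _    | no κa≢κd = a , d , inj₁ refl , inj₂ refl , κa≢κd
  ... | yes κa≡κc | yes κb≡κc | yes κa≡κd =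
    ⊥-elim (1+n≰n (fib (κ c) (a ∷ b ∷ c ∷ d ∷ []) distinct
                        (κa≡κc ∷ κb≡κc ∷ refl ∷ trans (sym κa≡κd) κa≡κc ∷ [])))
    where
    distinct : Unique (a ∷ b ∷ c ∷ d ∷ [])
    distinct = ((<⇒≢ a<b ∘ cong toℕ) ∷ (λ a≡c → e₁#e₂ (inj₁ refl) (inj₁ a≡c))
                                     ∷ (λ a≡d → e₁#e₂ (inj₁ refl) (inj₂ a≡d)) ∷ [])
             ∷ ((λ b≡c → e₁#e₂ (inj₂ refl) (inj₁ b≡c)) ∷ (λ b≡d → e₁#e₂ (inj₂ refl) (inj₂ b≡d)) ∷ [])
             ∷ ((<⇒≢ c<d ∘ cong toℕ) ∷ [])
             ∷ [] ∷ []

  rainbow⇒m≤3k : ∀ {k} {c : V → Fin k} → Fin n → IsRainbowVertexColoring E k c → m ≤ k * 3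
  rainbow⇒m≤3k w c-rainbow =
    subst (_≤ _) (length-tabulate id)
          (fibresAtMost⇒length≤-Fin _ (separating⇒fibresAtMost3 (rainbow⇒separating w c-rainbow))
                                      (Unique.allFin⁺ m))

  -- The colours of the copies of H are irrelevant: the rainbow paths below never pass through them.
  extend : ∀ {k} → (Fin m → Fin k) → V → Fin k
  extend κ (inj₁ a)       = κ a
  extend κ (inj₂ (e , _)) = κ (proj₁ (proj₁ e))

  separating⇒rainbow : ∀ {k} {κ : Fin m → Fin k} → Separating κ → IsRainbowVertexColoring E k (extend κ)
  separating⇒rainbow         sep (inj₁ a) (inj₁ b) u≢v = rainbowPath₀ _ (adjK (u≢v ∘ cong inj₁)) u≢v
  separating⇒rainbow         sep (inj₁ a) (inj₂ (e , _)) u≢v with a ∈ₑ? e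
  ... | yes a∈e = rainbowPath₀ _ a∈e u≢v
  ... | no  a∉e =
    rainbowPath₁ _ (inj₁ _) (adjK (a∉e ∘ inj₁)) (inj₁ refl) (a∉e ∘ inj₁ ∘ inj₁-injective) u≢v λ ()
  separating⇒rainbow         sep (inj₂ (e , _)) (inj₁ a) u≢v with a ∈ₑ? e
  ... | yes a∈e = rainbowPath₀ _ a∈e u≢v
  ... | no  a∉e =
    rainbowPath₁ _ (inj₁ _) (inj₁ refl) (adjK (a∉e ∘ inj₁ ∘ sym)) (λ ()) u≢v (a∉e ∘ inj₁ ∘ sym ∘ inj₁-injective)
  separating⇒rainbow {κ = κ} sep (inj₂ (e , _)) (inj₂ (e′ , _)) u≢v with shared-or-disjoint e e′
  ... | inj₁ (p , p∈e , p∈e′) = rainbowPath₁ _ (inj₁ p) p∈e p∈e′ (λ ()) u≢v (λ ())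
  ... | inj₂ e#e′ =
    let p , q , p∈e , q∈e′ , κp≢κq = sep e e′ e#e′
    in rainbowPath₂ _ (inj₁ p) (inj₁ q) p∈e (adjK (κp≢κq ∘ cong κ)) q∈e′
                    (λ ()) (λ ()) u≢v (λ ()) (λ ()) κp≢κq

  thirds-rainbow : IsRainbowVertexColoring E ((m + 2) / 3) (extend thirds)
  thirds-rainbow = separating⇒rainbow (fibresAtMost3⇒separating thirds-fibresAtMost3)

mainTheorem10 : (m n : ℕ) → 3 ≤ m → 2 ≤ n → (H : Graph n) → Connected (Adj H)
    → RVCIs (CoronaAdj (K m) H) ((m + 2) / 3)
mainTheorem10 m (suc n) 3≤m _ H _ =
  m≥n⇒m/n>0 (≤-trans 3≤m (m≤m+n m 2)) ,
  (extend thirds , thirds-rainbow) ,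
  λ { k _ (c , c-rainbow) → ⌈/3⌉-least (rainbow⇒m≤3k Data.Fin.zero c-rainbow) }
  where open CompleteCorona {m} H
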